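{- For all $n\ge 1$, $\pi^{c}(P_n)=\lceil 2n/3\rceil$, and for all $n\ge 3$, $\pi^{c}(C_n)=\lceil 2n/3\rceil$.
   Context: $P_n$ and $C_n$ are the path and cycle on $n$ vertices. A configuration of cops on a graph $G$ is a function $C:V(G)\to\mathbb{Z}_{\ge 0}$ of size $\sum_v C(v)$. A pebbling step from a vertex $u$ with at least two cops to an adjacent vertex $v$ removes two cops from $u$ and adds one cop to $v$. In the cops and robbers pebbling game, cops are placed according to $C$, then a robber chooses a starting vertex; thereafter, in each turn the cops make pebbling steps, after which the robber either moves to an adjacent vertex or stays put. The robber is captured when he occupies a vertex holding at least one cop. The cop pebbling number $\pi^{c}(G)$ is the minimum $m$ such that some configuration of size $m$ allows the cops to capture the robber regardless of how he starts and moves. -}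

module Defs where

open import Data.Nat using (ℕ; zero; suc; _+_; _*_; _∸_; _≤_; _≥_)
open import Data.Nat.DivMod using (_/_)
open import Data.Fin using (Fin; toℕ; _≟_)
open import Data.Nat.ListAction using (sum)
open import Data.List using () renaming (tabulate to listTabulate)
open import Data.Product using (Σ; ∃; _×_; _,_)
open import Data.Sum using (_⊎_)
open import Relation.Nullary using (does)
open import Data.Bool using (if_then_else_)
open import Relation.Binary.PropositionalEquality using (_≡_)
open import Relation.Binary.Construct.Closure.ReflexiveTransitive using (Star)

record Graph : Set₁ where
  field
    n   : ℕ
    Adj : Fin n → Fin n → Set
open Graph public

Path : ℕ → Graph
Path m = record { n = m ; Adj = λ i j → toℕ j ≡ suc (toℕ i) ⊎ toℕ i ≡ suc (toℕ j) }

Cycle : ℕ → Graph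
Cycle m = record
  { n = m
  ; Adj = λ i j → (toℕ j ≡ suc (toℕ i) ⊎ toℕ i ≡ suc (toℕ j))
                  ⊎ ((toℕ i ≡ 0 × toℕ j ≡ m ∸ 1) ⊎ (toℕ j ≡ 0 × toℕ i ≡ m ∸ 1)) }

Config : Graph → Set
Config G = Fin (n G) → ℕ

size : (G : Graph) → Config G → ℕ
size G C = sum (listTabulate C)

pebble : (G : Graph) → Config G → Fin (n G) → Fin (n G) → Config G
pebble G C u v w =
  (if does (w ≟ v) then 1 else 0) + (C w ∸ (if does (w ≟ u) then 2 else 0))

Step : (G : Graph) → Config G → Config G → Set
Step G C C' = Σ (Fin (n G)) λ u → Σ (Fin (n G)) λ v →
  Adj G u v × 2 ≤ C u × C' ≡ pebble G C u v

CopMove : (G : Graph) → Config G → Config G → Set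
CopMove G = Star (Step G)

-- CopWin G C r: with cops at C and robber at r, about to move (cops' turn,
-- or robber just arrived at r), the cops can force capture in finitely many turns.
data CopWin (G : Graph) : Config G → Fin (n G) → Set where
  caught : ∀ {C r} → C r ≥ 1 → CopWin G C r
  turn   : ∀ {C r} (C' : Config G) → CopMove G C C' →
           (C' r ≥ 1 ⊎ (∀ r' → (r' ≡ r ⊎ Adj G r r') → CopWin G C' r')) →
           CopWin G C r

Winning : (G : Graph) → Config G → Set
Winning G C = ∀ r → CopWin G C r

IsCopPebblingNumber : Graph → ℕ → Set
IsCopPebblingNumber G k =
  (Σ (Config G) λ C → size G C ≡ k × Winning G C)
  × (∀ (C : Config G) → Winning G C → k ≤ size G C)

ceil2n/3 : ℕ → ℕ
ceil2n/3 m = (2 * m + 2) / 3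

-- Upper bound: two cops on every vertex congruent to 1 mod 3, plus one cop on the last vertex
-- when n ≡ 1 (mod 3), leave every vertex occupied or next to a pile of two, so the robber is caught
-- after a single pebbling step.
--
-- Lower bound: a pile of x cops can send at most ⌊ x/2 ⌋ cops to a neighbour, so sweeping the cops
-- towards a vertex ρ from the left, carrying c + ⌊ x/2 ⌋ from vertex to vertex, bounds the number of
-- cops that can ever stand on the left neighbour of ρ; symmetrically from the right. A pebbling
-- step that does not involve ρ never increases either sweep. So if ρ is empty and both sweeps are
-- at most 1, the robber waits at ρ forever. Otherwise every vertex is covered (occupied, or reached
-- by a sweep of at least 2), and an amortised count along the left sweep, with potential x·[x ≥ 2]
-- on the carries, shows that each covered vertex uses up two thirds of a cop: 2n ≤ 3|C|. On the
-- cycle the sweeps run once around from ρ; unrolling it into a path of K + 2 periods and counting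
-- the K inner ones gives 2Kn ≤ 3(K + 2)|C| for every K, hence 2n ≤ 3|C| again.

module Submission where

open import Defs
open import Data.Nat
open import Data.Nat.Properties
open import Data.Nat.DivMod
open import Data.Nat.Divisibility using (divides)
open import Data.Nat.ListAction using (sum)
open import Data.Nat.Tactic.RingSolver using (solve-∀)
open import Data.Bool using (if_then_else_)
open import Data.Fin using (Fin; toℕ; fromℕ<) renaming (zero to fzero; suc to fsuc)
import Data.Fin as F
open import Data.Fin.Properties using (toℕ-fromℕ<; toℕ<n; all?; ¬∀⟶∃¬)
open import Data.List using () renaming (tabulate to listTabulate)
open import Data.Product using (_×_; _,_; ∃; proj₁; proj₂)
open import Data.Sum using (_⊎_; inj₁; inj₂)
open import Function using (_∘_)
open import Relation.Nullary using (¬_; Dec; does; yes; no; _⊎-dec_; contradiction)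
open import Relation.Nullary.Decidable using (dec-true; dec-false)
open import Relation.Binary.PropositionalEquality
open import Relation.Binary.Definitions using (tri<; tri≈; tri>)
open import Relation.Binary.Construct.Closure.ReflexiveTransitive using (ε; _◅_)

-- Sweeps

carry : ℕ → ℕ → ℕ
carry c x = c + ⌊ x /2⌋

carry-mono : ∀ {c c' x x'} → c' ≤ c → x' ≤ x → carry c' x' ≤ carry c x
carry-mono c'≤c x'≤x = +-mono-≤ c'≤c (⌊n/2⌋-mono x'≤x)

-- sweepRight f ℓ s t bounds the cops that can be gathered on s + t - 1 from the window
-- s, …, s + t - 1 when ℓ cops arrive from its left; sweepLeft gathers on s, with r arriving from the right.
sweepRight : (ℕ → ℕ) → ℕ → ℕ → ℕ → ℕ
sweepRight f ℓ s zero    = ℓ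
sweepRight f ℓ s (suc t) = sweepRight f (carry (f s) ℓ) (suc s) t

sweepLeft : (ℕ → ℕ) → ℕ → ℕ → ℕ → ℕ
sweepLeft f r s zero    = r
sweepLeft f r s (suc t) = carry (f s) (sweepLeft f r (suc s) t)

InWindow : ℕ → ℕ → ℕ → Set
InWindow s t k = s ≤ k × k < s + t

inWindow-head : ∀ s t → InWindow s (suc t) s
inWindow-head s t = ≤-refl , m<m+n s z<s

inWindow-tail : ∀ {s t k} → InWindow (suc s) t k → InWindow s (suc t) k
inWindow-tail {s} {t} (s<k , k<) = <⇒≤ s<k , ≤-trans k< (≤-reflexive (sym (+-suc s t)))

module _ {f f' : ℕ → ℕ} where

  sweepRight-mono : ∀ t s {ℓ ℓ'} → (∀ k → InWindow s t k → f' k ≤ f k) → ℓ' ≤ ℓ →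
                    sweepRight f' ℓ' s t ≤ sweepRight f ℓ s t
  sweepRight-mono zero    s below ℓ'≤ℓ = ℓ'≤ℓ
  sweepRight-mono (suc t) s below ℓ'≤ℓ =
    sweepRight-mono t (suc s) (λ k w → below k (inWindow-tail w))
      (carry-mono (below s (inWindow-head s t)) ℓ'≤ℓ)

  sweepLeft-mono : ∀ t s {r r'} → (∀ k → InWindow s t k → f' k ≤ f k) → r' ≤ r →
                   sweepLeft f' r' s t ≤ sweepLeft f r s t
  sweepLeft-mono zero    s below r'≤r = r'≤r
  sweepLeft-mono (suc t) s below r'≤r =
    carry-mono (below s (inWindow-head s t)) (sweepLeft-mono t (suc s) (λ k w → below k (inWindow-tail w)) r'≤r)

module _ (f : ℕ → ℕ) where

  sweepRight-split : ∀ i u s ℓ → sweepRight f ℓ s (i + u) ≡ sweepRight f (sweepRight f ℓ s i) (s + i) u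
  sweepRight-split zero    u s ℓ = cong (λ z → sweepRight f ℓ z u) (sym (+-identityʳ s))
  sweepRight-split (suc i) u s ℓ =
    trans (sweepRight-split i u (suc s) _)
      (cong (λ z → sweepRight f (sweepRight f ℓ s (suc i)) z u) (sym (+-suc s i)))

  sweepLeft-split : ∀ i u s r → sweepLeft f r s (i + u) ≡ sweepLeft f (sweepLeft f r (s + i) u) s i
  sweepLeft-split zero    u s r = cong (λ z → sweepLeft f r z u) (sym (+-identityʳ s))
  sweepLeft-split (suc i) u s r =
    cong (carry (f s)) (trans (sweepLeft-split i u (suc s) r)
      (cong (λ z → sweepLeft f (sweepLeft f r z u) (suc s) i) (sym (+-suc s i))))

sweepRight-snoc : ∀ f ℓ s t → sweepRight f ℓ s (suc t) ≡ carry (f (s + t)) (sweepRight f ℓ s t)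
sweepRight-snoc f ℓ s t = trans (cong (sweepRight f ℓ s) (+-comm 1 t)) (sweepRight-split f t 1 s ℓ)

sweepRight-last : ∀ f ℓ s {t k} → s ≤ k → suc k ≡ s + t → f k ≤ sweepRight f ℓ s t
sweepRight-last f ℓ s {zero} s≤k 1+k≡s =
  contradiction (≤-trans (≤-reflexive (trans 1+k≡s (+-identityʳ s))) s≤k) 1+n≰n
sweepRight-last f ℓ s {suc t} s≤k 1+k≡s+1+t rewrite suc-injective (trans 1+k≡s+1+t (+-suc s t)) =
  ≤-trans (m≤m+n _ _) (≤-reflexive (sym (sweepRight-snoc f ℓ s t)))

sweepLeft-head : ∀ f r s {t} → 0 < t → f s ≤ sweepLeft f r s t
sweepLeft-head f r s {suc t} _ = m≤m+n _ _

sweepRight-suffix : ∀ f s t → sweepRight f 0 s t ≤ sweepRight f 0 0 (s + t)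
sweepRight-suffix f s t =
  ≤-trans (sweepRight-mono t s (λ _ _ → ≤-refl) z≤n) (≤-reflexive (sym (sweepRight-split f s t 0 0)))

sweepLeft-prefix : ∀ f s t u → sweepLeft f 0 s t ≤ sweepLeft f 0 s (t + u)
sweepLeft-prefix f s t u =
  ≤-trans (sweepLeft-mono t s (λ _ _ → ≤-refl) z≤n) (≤-reflexive (sym (sweepLeft-split f t u s 0)))

CarryDominated : ℕ → ℕ → ℕ → ℕ → Set
CarryDominated a' b' a b = ∀ {x' x} → x' ≤ x → carry b' (carry a' x') ≤ carry b (carry a x)

-- A pebbling step between two consecutive vertices of a sweep, along its direction or against it,
-- does not increase what the sweep carries on.
carryDominated-along : ∀ {a' b' a b} → 2 + a' ≤ a → b' ≤ suc b → CarryDominated a' b' a b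
carryDominated-along {a'} {b'} {a} {b} 2+a'≤a b'≤1+b {x'} {x} x'≤x = begin
  b' + ⌊ carry a' x' /2⌋     ≤⟨ +-monoˡ-≤ _ b'≤1+b ⟩
  suc b + ⌊ carry a' x' /2⌋  ≡⟨ +-suc b _ ⟨
  b + ⌊ 2 + carry a' x' /2⌋  ≤⟨ +-monoʳ-≤ b (⌊n/2⌋-mono (+-mono-≤ 2+a'≤a (⌊n/2⌋-mono x'≤x))) ⟩
  b + ⌊ carry a x /2⌋        ∎
  where open ≤-Reasoning

carryDominated-against : ∀ {a' b' a b} → a' ≤ suc a → 2 + b' ≤ b → CarryDominated a' b' a b
carryDominated-against {a'} {b'} {a} {b} a'≤1+a 2+b'≤b {x'} {x} x'≤x = begin
  b' + ⌊ carry a' x' /2⌋    ≤⟨ +-monoʳ-≤ b' (⌊n/2⌋-mono (m≤n⇒m≤1+n (carry-mono a'≤1+a x'≤x))) ⟩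
  b' + suc ⌊ carry a x /2⌋  ≡⟨ +-suc b' _ ⟩
  suc b' + ⌊ carry a x /2⌋  ≤⟨ +-monoˡ-≤ _ (<⇒≤ 2+b'≤b) ⟩
  b + ⌊ carry a x /2⌋       ∎
  where open ≤-Reasoning

pair-window-end : ∀ s i j → 2 + (s + i) + j ≡ s + (i + (2 + j))
pair-window-end = solve-∀

module _ {f f' : ℕ → ℕ} (i j s : ℕ)
         (others : ∀ k → InWindow s (i + (2 + j)) k → k ≢ s + i → k ≢ suc (s + i) → f' k ≤ f k) where

  private
    p = s + i

    below-prefix : ∀ k → InWindow s i k → f' k ≤ f k
    below-prefix k (s≤k , k<p) =
      others k (s≤k , <-≤-trans k<p (+-monoʳ-≤ s (m≤m+n i _))) (<⇒≢ k<p) (<⇒≢ (m<n⇒m<1+n k<p))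

    below-suffix : ∀ k → InWindow (2 + p) j k → f' k ≤ f k
    below-suffix k (2+p≤k , k<) =
      others k (≤-trans (m≤m+n s i) (≤-trans (n≤1+n p) (<⇒≤ 2+p≤k)) ,
                <-≤-trans k< (≤-reflexive (pair-window-end s i j)))
             (λ k≡p → <⇒≢ (<-trans (n<1+n p) 2+p≤k) (sym k≡p))
             (λ k≡1+p → <⇒≢ 2+p≤k (sym k≡1+p))

  sweepRight-pair : CarryDominated (f' p) (f' (suc p)) (f p) (f (suc p)) → ∀ {ℓ ℓ'} → ℓ' ≤ ℓ →
                    sweepRight f' ℓ' s (i + (2 + j)) ≤ sweepRight f ℓ s (i + (2 + j))
  sweepRight-pair dominated {ℓ} {ℓ'} ℓ'≤ℓ = begin
    sweepRight f' ℓ' s (i + (2 + j))                   ≡⟨ sweepRight-split f' i (2 + j) s ℓ' ⟩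
    sweepRight f' (sweepRight f' ℓ' s i) p (2 + j)     ≤⟨ sweepRight-mono j (2 + p) below-suffix
                                                            (dominated (sweepRight-mono i s below-prefix ℓ'≤ℓ)) ⟩
    sweepRight f (sweepRight f ℓ s i) p (2 + j)        ≡⟨ sweepRight-split f i (2 + j) s ℓ ⟨
    sweepRight f ℓ s (i + (2 + j))                     ∎
    where open ≤-Reasoning

  sweepLeft-pair : CarryDominated (f' (suc p)) (f' p) (f (suc p)) (f p) → ∀ {r r'} → r' ≤ r →
                   sweepLeft f' r' s (i + (2 + j)) ≤ sweepLeft f r s (i + (2 + j))
  sweepLeft-pair dominated {r} {r'} r'≤r = begin
    sweepLeft f' r' s (i + (2 + j))                    ≡⟨ sweepLeft-split f' i (2 + j) s r' ⟩
    sweepLeft f' (sweepLeft f' r' p (2 + j)) s i       ≤⟨ sweepLeft-mono i s below-prefix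
                                                            (dominated (sweepLeft-mono j (2 + p) below-suffix r'≤r)) ⟩
    sweepLeft f (sweepLeft f r p (2 + j)) s i          ≡⟨ sweepLeft-split f i (2 + j) s r ⟨
    sweepLeft f r s (i + (2 + j))                      ∎
    where open ≤-Reasoning

SweepsDominated : (ℕ → ℕ) → (ℕ → ℕ) → ℕ → ℕ → Set
SweepsDominated f' f s t = (∀ {ℓ ℓ'} → ℓ' ≤ ℓ → sweepRight f' ℓ' s t ≤ sweepRight f ℓ s t)
                         × (∀ {r r'} → r' ≤ r → sweepLeft f' r' s t ≤ sweepLeft f r s t)

sweeps-mono : ∀ {f f' s t} → (∀ k → InWindow s t k → f' k ≤ f k) → SweepsDominated f' f s t
sweeps-mono {s = s} {t} below = sweepRight-mono t s below , sweepLeft-mono t s below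

window-pair : ∀ {s t p} → InWindow s t p → InWindow s t (suc p) →
              ∃ λ i → ∃ λ j → p ≡ s + i × t ≡ i + (2 + j)
window-pair {s} {t} (s≤p , _) (_ , 1+p<s+t) with m≤n⇒∃[o]m+o≡n s≤p | m≤n⇒∃[o]m+o≡n 1+p<s+t
... | i , refl | j , end≡ = i , j , refl , +-cancelˡ-≡ s t _ (trans (sym end≡) (pair-window-end s i j))

sweeps-pair : ∀ {f f' s t p} → InWindow s t p → InWindow s t (suc p) →
              (∀ k → InWindow s t k → k ≢ p → k ≢ suc p → f' k ≤ f k) →
              CarryDominated (f' p) (f' (suc p)) (f p) (f (suc p)) →
              CarryDominated (f' (suc p)) (f' p) (f (suc p)) (f p) →
              SweepsDominated f' f s t
sweeps-pair {s = s} p∈ 1+p∈ others rightward leftward with window-pair p∈ 1+p∈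
... | i , j , refl , refl = sweepRight-pair i j s others rightward , sweepLeft-pair i j s others leftward

Adjacent : ℕ → ℕ → Set
Adjacent a b = b ≡ suc a ⊎ a ≡ suc b

sweeps-step : ∀ {f f' s t a b} → Adjacent a b → InWindow s t a → InWindow s t b →
              2 + f' a ≤ f a → f' b ≤ suc (f b) →
              (∀ k → InWindow s t k → k ≢ a → k ≢ b → f' k ≤ f k) →
              SweepsDominated f' f s t
sweeps-step (inj₁ refl) a∈ b∈ source target others =
  sweeps-pair a∈ b∈ others (carryDominated-along source target) (carryDominated-against target source)
sweeps-step (inj₂ refl) a∈ b∈ source target others =
  sweeps-pair b∈ a∈ (λ k w k≢b k≢a → others k w k≢a k≢b)
    (carryDominated-against target source) (carryDominated-along source target)

-- Window sums and periodicity

windowSum : (ℕ → ℕ) → ℕ → ℕ → ℕ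
windowSum f s zero    = 0
windowSum f s (suc t) = f s + windowSum f (suc s) t

windowSum-shift : ∀ f d t s → windowSum (λ k → f (d + k)) s t ≡ windowSum f (d + s) t
windowSum-shift f d zero    s = refl
windowSum-shift f d (suc t) s =
  cong (f (d + s) +_) (trans (windowSum-shift f d t (suc s)) (cong (λ z → windowSum f z t) (+-suc d s)))

windowSum-split : ∀ f i u s → windowSum f s (i + u) ≡ windowSum f s i + windowSum f (s + i) u
windowSum-split f zero    u s = cong (λ z → windowSum f z u) (sym (+-identityʳ s))
windowSum-split f (suc i) u s =
  trans (cong (f s +_) (trans (windowSum-split f i u (suc s)) 
          (cong (λ z → windowSum f (suc s) i + windowSum f z u) (sym (+-suc s i)))))
        (sym (+-assoc (f s) _ _))

windowSum-cong : ∀ {f f'} t s → (∀ k → InWindow s t k → f k ≡ f' k) → windowSum f s t ≡ windowSum f' s t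
windowSum-cong zero    s eq = refl
windowSum-cong (suc t) s eq =
  cong₂ _+_ (eq s (inWindow-head s t)) (windowSum-cong t (suc s) (λ k k∈ → eq k (inWindow-tail k∈)))

module _ {f : ℕ → ℕ} {d : ℕ} (period : ∀ k → f (k + d) ≡ f k) where

  sweepRight-periodic : ∀ t s ℓ → sweepRight f ℓ (s + d) t ≡ sweepRight f ℓ s t
  sweepRight-periodic zero    s ℓ = refl
  sweepRight-periodic (suc t) s ℓ rewrite period s = sweepRight-periodic t (suc s) _

  sweepLeft-periodic : ∀ t s r → sweepLeft f r (s + d) t ≡ sweepLeft f r s t
  sweepLeft-periodic zero    s r = refl
  sweepLeft-periodic (suc t) s r rewrite period s | sweepLeft-periodic t (suc s) r = refl

  windowSum-periodic : ∀ t s → windowSum f (s + d) t ≡ windowSum f s t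
  windowSum-periodic zero    s = refl
  windowSum-periodic (suc t) s rewrite period s | windowSum-periodic t (suc s) = refl

windowSum-periods : ∀ {f d} → (∀ k → f (k + d) ≡ f k) → ∀ q → windowSum f 0 (q * d) ≡ q * windowSum f 0 d
windowSum-periods period zero    = refl
windowSum-periods {f} {d} period (suc q) =
  trans (windowSum-split f d (q * d) 0)
        (cong (windowSum f 0 d +_) (trans (windowSum-periodic period (q * d) 0) (windowSum-periods period q)))

-- Counting covered vertices

movable : ℕ → ℕ
movable zero          = 0
movable (suc zero)    = 0
movable (suc (suc x)) = suc (suc x)

movable-≤ : ∀ x → movable x ≤ x
movable-≤ zero          = z≤n
movable-≤ (suc zero)    = z≤n
movable-≤ (suc (suc x)) = ≤-refl

⌊/2⌋≤movable : ∀ x → ⌊ x /2⌋ ≤ movable x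
⌊/2⌋≤movable zero          = z≤n
⌊/2⌋≤movable (suc zero)    = z≤n
⌊/2⌋≤movable (suc (suc x)) = ⌊n/2⌋≤n (suc (suc x))

movable-carry : ∀ c x → movable (carry c x) ≤ c + movable x
movable-carry c x = ≤-trans (movable-≤ _) (+-monoʳ-≤ c (⌊/2⌋≤movable x))

movable-half : ∀ x → movable ⌊ x /2⌋ ≤ movable x
movable-half = movable-carry 0

movable-carry₁ : ∀ x → movable (carry 1 x) ≤ movable x
movable-carry₁ zero          = z≤n
movable-carry₁ (suc zero)    = z≤n
movable-carry₁ (suc (suc x)) = s≤s (s≤s (⌊n/2⌋≤n x))

movable-half-strict : ∀ x → 2 ≤ x → 2 + movable ⌊ x /2⌋ ≤ movable x
movable-half-strict (suc (suc x)) _ = s≤s (s≤s (≤-trans (movable-carry₁ x) (movable-≤ x)))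
movable-half-strict (suc zero) (s≤s ())

Covered : ℕ → ℕ → ℕ → Set
Covered c ℓ r = 1 ≤ c ⊎ 2 ≤ ℓ ⊎ 2 ≤ r

covered? : ∀ c ℓ r → Dec (Covered c ℓ r)
covered? c ℓ r = 1 ≤? c ⊎-dec 2 ≤? ℓ ⊎-dec 2 ≤? r

covered-mono : ∀ {c ℓ r c' ℓ' r'} → Covered c ℓ r → c ≤ c' → ℓ ≤ ℓ' → r ≤ r' → Covered c' ℓ' r'
covered-mono (inj₁ 1≤c)          c≤c' _ _ = inj₁ (≤-trans 1≤c c≤c')
covered-mono (inj₂ (inj₁ 2≤ℓ)) _ ℓ≤ℓ' _ = inj₂ (inj₁ (≤-trans 2≤ℓ ℓ≤ℓ'))
covered-mono (inj₂ (inj₂ 2≤r)) _ _ r≤r' = inj₂ (inj₂ (≤-trans 2≤r r≤r'))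

covered-bound : ∀ {c ℓ r} → Covered c ℓ r →
                2 + movable (carry c r) + movable (carry c ℓ) ≤ 3 * c + movable ℓ + movable r
covered-bound {suc zero} {ℓ} {r} _ = begin
  2 + movable (carry 1 r) + movable (carry 1 ℓ)
    ≤⟨ +-mono-≤ (+-monoʳ-≤ 2 (movable-carry₁ r)) (movable-carry₁ ℓ) ⟩
  2 + movable r + movable ℓ                     ≤⟨ n≤1+n _ ⟩
  3 + movable r + movable ℓ                     ≡⟨ rearrange (movable r) (movable ℓ) ⟩
  3 * 1 + movable ℓ + movable r                 ∎
  where
  open ≤-Reasoning
  rearrange : ∀ a b → 3 + a + b ≡ 3 * 1 + b + a
  rearrange = solve-∀
covered-bound {suc (suc c)} {ℓ} {r} _ = begin
  2 + movable (carry (2 + c) r) + movable (carry (2 + c) ℓ)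
    ≤⟨ +-mono-≤ (+-monoʳ-≤ 2 (movable-carry (2 + c) r)) (movable-carry (2 + c) ℓ) ⟩
  2 + (2 + c + movable r) + (2 + c + movable ℓ)
    ≤⟨ m≤m+n _ c ⟩
  2 + (2 + c + movable r) + (2 + c + movable ℓ) + c
    ≡⟨ rearrange c (movable r) (movable ℓ) ⟩
  3 * (2 + c) + movable ℓ + movable r ∎
  where
  open ≤-Reasoning
  rearrange : ∀ c a b → 2 + (2 + c + a) + (2 + c + b) + c ≡ 3 * (2 + c) + b + a
  rearrange = solve-∀
covered-bound {zero} {ℓ} {r} (inj₂ (inj₁ 2≤ℓ)) =
  ≤-trans (≤-reflexive (rearrange (movable ⌊ r /2⌋) (movable ⌊ ℓ /2⌋)))
    (+-mono-≤ (movable-half-strict ℓ 2≤ℓ) (movable-half r))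
  where
  rearrange : ∀ a b → 2 + a + b ≡ 2 + b + a
  rearrange = solve-∀
covered-bound {zero} {ℓ} {r} (inj₂ (inj₂ 2≤r)) =
  ≤-trans (+-mono-≤ (movable-half-strict r 2≤r) (movable-half ℓ)) (≤-reflexive (+-comm (movable r) _))

carry-bound : ∀ c ℓ r → movable (carry c r) + movable (carry c ℓ) ≤ 3 * c + movable ℓ + movable r
carry-bound c ℓ r = begin
  movable (carry c r) + movable (carry c ℓ)  ≤⟨ +-mono-≤ (movable-carry c r) (movable-carry c ℓ) ⟩
  c + movable r + (c + movable ℓ)            ≤⟨ m≤m+n _ c ⟩
  c + movable r + (c + movable ℓ) + c        ≡⟨ rearrange c (movable r) (movable ℓ) ⟩
  3 * c + movable ℓ + movable r              ∎
  where
  open ≤-Reasoning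
  rearrange : ∀ c a b → c + a + (c + b) + c ≡ 3 * c + b + a
  rearrange = solve-∀

coverage : ℕ → ℕ → ℕ → ℕ
coverage c ℓ r = if does (covered? c ℓ r) then 1 else 0

coveredCount : (ℕ → ℕ) → ℕ → ℕ → ℕ → ℕ
coveredCount f ℓ s zero    = 0
coveredCount f ℓ s (suc t) = coverage (f s) ℓ (sweepLeft f 0 (suc s) t) + coveredCount f (carry (f s) ℓ) (suc s) t

cell-bound : ∀ c ℓ r → 2 * coverage c ℓ r + movable (carry c r) + movable (carry c ℓ)
                       ≤ 3 * c + movable ℓ + movable r
cell-bound c ℓ r with covered? c ℓ r
... | yes covered rewrite dec-true (covered? c ℓ r) covered = covered-bound covered
... | no ¬covered rewrite dec-false (covered? c ℓ r) ¬covered = carry-bound c ℓ r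

coveredCount-bound : ∀ f t s ℓ →
                     2 * coveredCount f ℓ s t + movable (sweepLeft f 0 s t) ≤ 3 * windowSum f s t + movable ℓ
coveredCount-bound f zero    s ℓ = z≤n
coveredCount-bound f (suc t) s ℓ =
  add-bounds (coverage (f s) ℓ (sweepLeft f 0 (suc s) t)) (coveredCount f (carry (f s) ℓ) (suc s) t)
             (f s) (windowSum f (suc s) t)
    (cell-bound (f s) ℓ (sweepLeft f 0 (suc s) t)) (coveredCount-bound f t (suc s) (carry (f s) ℓ))
  where
  add-bounds : ∀ i C c S {X Y L R} → 2 * i + X + Y ≤ 3 * c + L + R → 2 * C + R ≤ 3 * S + Y →
               2 * (i + C) + X ≤ 3 * (c + S) + L
  add-bounds i C c S {X} {Y} {L} {R} cell rest = +-cancelʳ-≤ (R + Y) _ _ (begin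
    2 * (i + C) + X + (R + Y)             ≡⟨ regroup i C X Y R ⟩
    (2 * i + X + Y) + (2 * C + R)         ≤⟨ +-mono-≤ cell rest ⟩
    (3 * c + L + R) + (3 * S + Y)         ≡⟨ regroup′ c S L R Y ⟩
    3 * (c + S) + L + (R + Y)             ∎)
    where
    open ≤-Reasoning
    regroup : ∀ i C X Y R → 2 * (i + C) + X + (R + Y) ≡ (2 * i + X + Y) + (2 * C + R)
    regroup = solve-∀
    regroup′ : ∀ c S L R Y → (3 * c + L + R) + (3 * S + Y) ≡ 3 * (c + S) + L + (R + Y)
    regroup′ = solve-∀

CoveredAt : (ℕ → ℕ) → ℕ → ℕ → Set
CoveredAt f N p = Covered (f p) (sweepRight f 0 0 p) (sweepLeft f 0 (suc p) (N ∸ suc p))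

covered⇒coverage≡1 : ∀ {c ℓ r} → Covered c ℓ r → coverage c ℓ r ≡ 1
covered⇒coverage≡1 {c} {ℓ} {r} covered rewrite dec-true (covered? c ℓ r) covered = refl

coveredCount-≥ : ∀ {f N lo hi} t s {ℓ} → s + t ≡ N → ℓ ≡ sweepRight f 0 0 s → s ≤ lo → hi ≤ N →
                 (∀ p → lo ≤ p → p < hi → CoveredAt f N p) → hi ∸ lo ≤ coveredCount f ℓ s t
coveredCount-≥ {lo = lo} {hi} zero s s+0≡N _ s≤lo hi≤N _ =
  ≤-reflexive (m≤n⇒m∸n≡0 (≤-trans hi≤N (≤-trans (≤-reflexive (trans (sym s+0≡N) (+-identityʳ s))) s≤lo)))
coveredCount-≥ {f} {N} {lo} {hi} (suc t) s {ℓ} s+t≡N ℓ≡ s≤lo hi≤N covered with m≤n⇒m<n∨m≡n s≤lo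
... | inj₁ s<lo =
  ≤-trans (coveredCount-≥ t (suc s) (trans (sym (+-suc s t)) s+t≡N) ℓ′≡ s<lo hi≤N covered) (m≤n+m _ _)
  where ℓ′≡ = trans (cong (carry (f s)) ℓ≡) (sym (sweepRight-snoc f 0 0 s))
... | inj₂ refl with s <? hi
...   | no s≮hi = ≤-trans (≤-reflexive (m≤n⇒m∸n≡0 (≮⇒≥ s≮hi))) z≤n
...   | yes s<hi =
  begin
    hi ∸ s
      ≤⟨ m≤n+o⇒m∸n≤o hi s (≤-trans (m≤n+m∸n hi (suc s)) (≤-reflexive (sym (+-suc s _)))) ⟩
    1 + (hi ∸ suc s)
      ≤⟨ +-monoʳ-≤ 1 (coveredCount-≥ t (suc s) (trans (sym (+-suc s t)) s+t≡N) ℓ′≡ ≤-refl hi≤N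
                       (λ p 1+s≤p → covered p (<⇒≤ 1+s≤p))) ⟩
    1 + coveredCount f (carry (f s) ℓ) (suc s) t
      ≡⟨ cong (_+ coveredCount f (carry (f s) ℓ) (suc s) t) (covered⇒coverage≡1 covered-s) ⟨
    coveredCount f ℓ s (suc t)
      ∎
  where
  open ≤-Reasoning
  ℓ′≡ = trans (cong (carry (f s)) ℓ≡) (sym (sweepRight-snoc f 0 0 s))
  N∸1+s≡t : N ∸ suc s ≡ t
  N∸1+s≡t = trans (cong (_∸ suc s) (trans (sym s+t≡N) (+-suc s t))) (m+n∸m≡n (suc s) t)
  covered-s : Covered (f s) ℓ (sweepLeft f 0 (suc s) t)
  covered-s = subst₂ (Covered (f s)) (sym ℓ≡) (cong (sweepLeft f 0 (suc s)) N∸1+s≡t) (covered s ≤-refl s<hi)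

scaled-slack : ∀ k x y → k * y ≤ (k + 2) * x → 2 * x < k → y ≤ x
scaled-slack k x y ky≤[k+2]x 2x<k = ≮⇒≥ λ x<y → <⇒≱ 2x<k (+-cancelˡ-≤ (k * x) k (2 * x) (begin
  k * x + k      ≡⟨ +-comm (k * x) k ⟩
  k + k * x      ≡⟨ *-suc k x ⟨
  k * suc x      ≤⟨ *-monoʳ-≤ k x<y ⟩
  k * y          ≤⟨ ky≤[k+2]x ⟩
  (k + 2) * x    ≡⟨ *-distribʳ-+ x k 2 ⟩
  k * x + 2 * x  ∎))
  where open ≤-Reasoning

[x+k*3]/3 : ∀ x k → (x + k * 3) / 3 ≡ x / 3 + k
[x+k*3]/3 x k = trans (+-distrib-/-∣ʳ x (divides k refl)) (cong (x / 3 +_) (m*n/n≡m k 3))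

ceil2n/3-≤ : ∀ m S → 2 * m ≤ 3 * S → ceil2n/3 m ≤ S
ceil2n/3-≤ m S 2m≤3S = begin
  (2 * m + 2) / 3  ≤⟨ /-monoˡ-≤ 3 (+-monoˡ-≤ 2 (≤-trans 2m≤3S (≤-reflexive (*-comm 3 S)))) ⟩
  (S * 3 + 2) / 3  ≡⟨ cong (_/ 3) (+-comm (S * 3) 2) ⟩
  (2 + S * 3) / 3  ≡⟨ [x+k*3]/3 2 S ⟩
  S                ∎
  where open ≤-Reasoning

-- The game on configurations extended by zero

module _ (G : Graph) (r : Fin (n G)) (Safe : Config G → Set)
         (safe-empty : ∀ {C} → Safe C → C r ≡ 0)
         (safe-step : ∀ {C C'} → Safe C → Step G C C' → Safe C') where

  safe-move : ∀ {C C'} → Safe C → CopMove G C C' → Safe C'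
  safe-move safe ε               = safe
  safe-move safe (step ◅ steps) = safe-move (safe-step safe step) steps

  -- The robber never leaves r.
  safe-evades : ∀ {C} → Safe C → ¬ CopWin G C r
  safe-evades safe (caught 1≤Cr)
    rewrite safe-empty safe = 1+n≰n 1≤Cr
  safe-evades safe (turn C' move (inj₁ 1≤C'r))
    rewrite safe-empty (safe-move safe move) = 1+n≰n 1≤C'r
  safe-evades safe (turn C' move (inj₂ next)) =
    safe-evades (safe-move safe move) (next r (inj₁ refl))

extend : ∀ {m} → (Fin m → ℕ) → ℕ → ℕ
extend {zero}  C k       = 0
extend {suc m} C zero    = C fzero
extend {suc m} C (suc k) = extend (C ∘ fsuc) k

extend-toℕ : ∀ {m} (C : Fin m → ℕ) w → extend C (toℕ w) ≡ C w
extend-toℕ C fzero    = refl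
extend-toℕ C (fsuc w) = extend-toℕ (C ∘ fsuc) w

extend-≥ : ∀ {m} (C : Fin m → ℕ) k → m ≤ k → extend C k ≡ 0
extend-≥ {zero}  C k       _         = refl
extend-≥ {suc m} C (suc k) (s≤s m≤k) = extend-≥ (C ∘ fsuc) k m≤k

extend-fromℕ< : ∀ {m} (C : Fin m → ℕ) {k} (k<m : k < m) → extend C k ≡ C (fromℕ< k<m)
extend-fromℕ< C k<m = trans (cong (extend C) (sym (toℕ-fromℕ< k<m))) (extend-toℕ C (fromℕ< k<m))

sum-tabulate≡windowSum : ∀ {m} (C : Fin m → ℕ) → sum (listTabulate C) ≡ windowSum (extend C) 0 m
sum-tabulate≡windowSum {zero}  C = refl
sum-tabulate≡windowSum {suc m} C =
  cong (C fzero +_) (trans (sum-tabulate≡windowSum (C ∘ fsuc)) (windowSum-shift (extend C) 1 m 0))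

record PebbleStep (f f' : ℕ → ℕ) (a b : ℕ) : Set where
  field
    source : 2 + f' a ≤ f a
    target : f' b ≤ suc (f b)
    others : ∀ k → k ≢ a → k ≢ b → f' k ≤ f k

module _ (G : Graph) (C : Config G) {u v : Fin (n G)} where

  pebble-source : u ≢ v → 2 ≤ C u → 2 + pebble G C u v u ≤ C u
  pebble-source u≢v 2≤Cu with u F.≟ v | u F.≟ u
  ... | yes u≡v | _        = contradiction u≡v u≢v
  ... | no _    | no u≢u   = contradiction refl u≢u
  ... | no _    | yes _    = ≤-reflexive (trans (+-comm 2 _) (m∸n+n≡m 2≤Cu))

  pebble-target : pebble G C u v v ≤ suc (C v)
  pebble-target with v F.≟ v | v F.≟ u
  ... | no v≢v | _     = contradiction refl v≢v
  ... | yes _  | yes _ = s≤s (m∸n≤m _ 2)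
  ... | yes _  | no _  = ≤-refl

  pebble-other : ∀ w → w ≢ u → w ≢ v → pebble G C u v w ≤ C w
  pebble-other w w≢u w≢v with w F.≟ v | w F.≟ u
  ... | yes w≡v | _       = contradiction w≡v w≢v
  ... | no _    | yes w≡u = contradiction w≡u w≢u
  ... | no _    | no _    = ≤-refl

step⇒pebbleStep : ∀ G {C : Config G} {u v} → u ≢ v → 2 ≤ C u →
                  PebbleStep (extend C) (extend (pebble G C u v)) (toℕ u) (toℕ v)
step⇒pebbleStep G {C} {u} {v} u≢v 2≤Cu = record
  { source = subst₂ (λ x y → 2 + x ≤ y) (sym (extend-toℕ _ u)) (sym (extend-toℕ C u))
                    (pebble-source G C u≢v 2≤Cu)
  ; target = subst₂ (λ x y → x ≤ suc y) (sym (extend-toℕ _ v)) (sym (extend-toℕ C v))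
                    (pebble-target G C)
  ; others = others
  }
  where
  others : ∀ k → k ≢ toℕ u → k ≢ toℕ v → extend (pebble G C u v) k ≤ extend C k
  others k k≢u k≢v with k <? n G
  ... | no k≮n rewrite extend-≥ (pebble G C u v) k (≮⇒≥ k≮n) = z≤n
  ... | yes k<n = subst₂ _≤_ (sym (extend-fromℕ< (pebble G C u v) k<n)) (sym (extend-fromℕ< C k<n))
                             (pebble-other G C w (λ w≡u → k≢u (trans (sym w≡k) (cong toℕ w≡u)))
                                                 (λ w≡v → k≢v (trans (sym w≡k) (cong toℕ w≡v))))
    where
    w = fromℕ< k<n
    w≡k : toℕ w ≡ k
    w≡k = toℕ-fromℕ< k<n

module _ {f f' a b} (step : PebbleStep f f' a b) where
  open PebbleStep step

  pebbleStep-source≥2 : 2 ≤ f a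
  pebbleStep-source≥2 = m+n≤o⇒m≤o 2 source

  step-sweeps-inside : ∀ {s t} → Adjacent a b → InWindow s t a → InWindow s t b → SweepsDominated f' f s t
  step-sweeps-inside adj a∈ b∈ = sweeps-step adj a∈ b∈ source target (λ k _ → others k)

  step-sweeps-outside : ∀ {s t} → ¬ InWindow s t a → ¬ InWindow s t b → SweepsDominated f' f s t
  step-sweeps-outside a∉ b∉ =
    sweeps-mono (λ k k∈ → others k (λ { refl → a∉ k∈ }) (λ { refl → b∉ k∈ }))

Quiet : ℕ → ℕ → ℕ → Set
Quiet c ℓ r = c ≡ 0 × ℓ ≤ 1 × r ≤ 1

uncovered⇒quiet : ∀ {c ℓ r} → ¬ Covered c ℓ r → Quiet c ℓ r
uncovered⇒quiet {c} {ℓ} {r} ¬covered =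
  n≤0⇒n≡0 (≮⇒≥ (¬covered ∘ inj₁)) ,
  ≮⇒≥ (¬covered ∘ inj₂ ∘ inj₁) ,
  ≮⇒≥ (¬covered ∘ inj₂ ∘ inj₂)

quiet-dominated : ∀ {c ℓ r c' ℓ' r'} → Quiet c ℓ r → c' ≤ c → ℓ' ≤ ℓ → r' ≤ r → Quiet c' ℓ' r'
quiet-dominated (c≡0 , ℓ≤1 , r≤1) c'≤c ℓ'≤ℓ r'≤r =
  n≤0⇒n≡0 (≤-trans c'≤c (≤-reflexive c≡0)) , ≤-trans ℓ'≤ℓ ℓ≤1 , ≤-trans r'≤r r≤1

module _ (G : Graph) (r : Fin (n G)) (Q : (ℕ → ℕ) → Set)
         (quiet-empty : ∀ {f} → Q f → f (toℕ r) ≡ 0)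
         (quiet-step : ∀ {f f' u v} → Adj G u v → PebbleStep f f' (toℕ u) (toℕ v) → Q f → Q f')
         (irreflexive : ∀ {u v} → Adj G u v → u ≢ v) where

  quiet-evades : ∀ {C} → Q (extend C) → ¬ CopWin G C r
  quiet-evades = safe-evades G r (Q ∘ extend) (λ {C} q → trans (sym (extend-toℕ C r)) (quiet-empty q))
    (λ { q (u , v , adj , 2≤Cu , refl) → quiet-step adj (step⇒pebbleStep G (irreflexive adj) 2≤Cu) q })

-- Paths

adjacent-irreflexive : ∀ {a b} → Adjacent a b → a ≢ b
adjacent-irreflexive (inj₁ refl) ()
adjacent-irreflexive (inj₂ refl) ()

adjacent-same-side : ∀ {a b ρ} → Adjacent a b → a ≢ ρ → b ≢ ρ → (a < ρ × b < ρ) ⊎ (ρ < a × ρ < b)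
adjacent-same-side {a} {b} {ρ} adj a≢ρ b≢ρ with <-cmp a ρ | adj
... | tri≈ _ a≡ρ _ | _         = contradiction a≡ρ a≢ρ
... | tri< a<ρ _ _ | inj₁ refl = inj₁ (a<ρ , ≤∧≢⇒< a<ρ b≢ρ)
... | tri< a<ρ _ _ | inj₂ refl = inj₁ (a<ρ , <-trans (n<1+n b) a<ρ)
... | tri> _ _ ρ<a | inj₁ refl = inj₂ (ρ<a , <-trans ρ<a (n<1+n a))
... | tri> _ _ ρ<a | inj₂ refl = inj₂ (ρ<a , ≤∧≢⇒< (≤-pred ρ<a) (b≢ρ ∘ sym))

QuietAt : (ℕ → ℕ) → ℕ → ℕ → Set
QuietAt f N p = Quiet (f p) (sweepRight f 0 0 p) (sweepLeft f 0 (suc p) (N ∸ suc p))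

pathQuiet-neighbour : ∀ {m ρ f a} → a < m → Adjacent a ρ → 2 ≤ f a → ¬ QuietAt f m ρ
pathQuiet-neighbour {f = f} _ (inj₁ refl) 2≤fa (_ , left≤1 , _) =
  1+n≰n (≤-trans (≤-trans 2≤fa (sweepRight-last f 0 0 z≤n refl)) left≤1)
pathQuiet-neighbour {f = f} {a} a<m (inj₂ refl) 2≤fa (_ , _ , right≤1) =
  1+n≰n (≤-trans (≤-trans 2≤fa (sweepLeft-head f 0 a (m<n⇒0<n∸m a<m))) right≤1)

pathQuiet-step : ∀ {m ρ f f' a b} → ρ < m → a < m → b < m → Adjacent a b →
                 PebbleStep f f' a b → QuietAt f m ρ → QuietAt f' m ρ
pathQuiet-step {m} {ρ} {f} {f'} {a} {b} ρ<m a<m b<m adj step quiet@(fρ≡0 , _)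
  with a ≟ ρ | b ≟ ρ
... | yes refl | _        = contradiction (≤-trans (pebbleStep-source≥2 step) (≤-reflexive fρ≡0)) λ ()
... | no a≢ρ   | yes refl = contradiction quiet (pathQuiet-neighbour a<m adj (pebbleStep-source≥2 step))
... | no a≢ρ   | no b≢ρ   =
  quiet-dominated quiet (others ρ (a≢ρ ∘ sym) (b≢ρ ∘ sym)) (proj₁ left ≤-refl) (proj₂ right ≤-refl)
  where
  open PebbleStep step
  right-end : ∀ {k} → k < m → k < suc ρ + (m ∸ suc ρ)
  right-end k<m = <-≤-trans k<m (≤-reflexive (sym (m+[n∸m]≡n ρ<m)))
  dominated : SweepsDominated f' f 0 ρ × SweepsDominated f' f (suc ρ) (m ∸ suc ρ)
  dominated with adjacent-same-side adj a≢ρ b≢ρ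
  ... | inj₁ (a<ρ , b<ρ) =
    step-sweeps-inside step adj (z≤n , a<ρ) (z≤n , b<ρ) ,
    step-sweeps-outside step {suc ρ} {m ∸ suc ρ} (λ (ρ<a , _) → <-asym a<ρ ρ<a) (λ (ρ<b , _) → <-asym b<ρ ρ<b)
  ... | inj₂ (ρ<a , ρ<b) =
    step-sweeps-outside step {0} {ρ} (λ (_ , a<ρ) → <-asym a<ρ ρ<a) (λ (_ , b<ρ) → <-asym b<ρ ρ<b) ,
    step-sweeps-inside step adj (ρ<a , right-end a<m) (ρ<b , right-end b<m)
  left  = proj₁ dominated
  right = proj₂ dominated

path-count : ∀ {f m} → (∀ p → p < m → CoveredAt f m p) → 2 * m ≤ 3 * windowSum f 0 m
path-count {f} {m} covered = begin
  2 * m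
    ≤⟨ *-monoʳ-≤ 2 (coveredCount-≥ {lo = 0} m 0 refl refl z≤n ≤-refl (λ p _ → covered p)) ⟩
  2 * coveredCount f 0 0 m                                ≤⟨ m≤m+n _ _ ⟩
  2 * coveredCount f 0 0 m + movable (sweepLeft f 0 0 m)  ≤⟨ coveredCount-bound f m 0 0 ⟩
  3 * windowSum f 0 m + 0                                 ≡⟨ +-identityʳ _ ⟩
  3 * windowSum f 0 m                                     ∎
  where open ≤-Reasoning

path-winning⇒size≥ : ∀ m (C : Config (Path m)) → Winning (Path m) C → ceil2n/3 m ≤ size (Path m) C
path-winning⇒size≥ m C win with all? (λ (r : Fin m) → covered? _ _ _)
... | yes allCovered =
  ceil2n/3-≤ m _ (subst (λ S → 2 * m ≤ 3 * S) (sym (sum-tabulate≡windowSum C))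
    (path-count (λ p p<m → subst (CoveredAt (extend C) m) (toℕ-fromℕ< p<m) (allCovered (fromℕ< p<m)))))
... | no notAll with ¬∀⟶∃¬ m _ (λ r → covered? _ _ _) notAll
...   | r , ¬covered =
  contradiction (win r) (quiet-evades (Path m) r (λ f → QuietAt f m (toℕ r)) proj₁
    (λ {_} {_} {u} {v} adj → pathQuiet-step (toℕ<n r) (toℕ<n u) (toℕ<n v) adj)
    (λ adj → adjacent-irreflexive adj ∘ cong toℕ)
    (uncovered⇒quiet ¬covered))

-- Cycles

module _ (m₁ : ℕ) where

  private
    M = suc m₁

  CycleAdjacent : ℕ → ℕ → Set
  CycleAdjacent a b = Adjacent a b ⊎ ((a ≡ 0 × b ≡ m₁) ⊎ (b ≡ 0 × a ≡ m₁))

  -- The robber at ρ sees the cycle cut open at ρ: positions suc ρ, …, ρ + m₁ of periodic f list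
  -- every other vertex exactly once, and Lift ρ x p says that vertex x sits at position p.
  data Lift (ρ x : ℕ) : ℕ → Set where
    above : ρ < x → Lift ρ x x
    below : x < ρ → Lift ρ x (x + M)

  lift : ∀ {ρ x} → x ≢ ρ → ∃ (Lift ρ x)
  lift {ρ} {x} x≢ρ with <-cmp x ρ
  ... | tri< x<ρ _ _ = _ , below x<ρ
  ... | tri≈ _ x≡ρ _ = contradiction x≡ρ x≢ρ
  ... | tri> _ _ ρ<x = _ , above ρ<x

  lift-unique : ∀ {ρ x p p'} → Lift ρ x p → Lift ρ x p' → p ≡ p'
  lift-unique (above _)   (above _)   = refl
  lift-unique (below _)   (below _)   = refl
  lift-unique (above ρ<x) (below x<ρ) = contradiction ρ<x (<-asym x<ρ)
  lift-unique (below x<ρ) (above ρ<x) = contradiction ρ<x (<-asym x<ρ)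

  lift-∈ : ∀ {ρ x p} → ρ < M → x < M → Lift ρ x p → InWindow (suc ρ) m₁ p
  lift-∈ {ρ} {x} ρ<M x<M (above ρ<x) = ρ<x , <-≤-trans x<M (s≤s (m≤n+m m₁ ρ))
  lift-∈ {ρ} {x} ρ<M x<M (below x<ρ) =
    <-≤-trans ρ<M (m≤n+m M x) , ≤-trans (≤-reflexive (+-suc (suc x) m₁)) (s≤s (+-monoˡ-≤ m₁ x<ρ))

  lift-% : ∀ {ρ x p} → x < M → Lift ρ x p → p % M ≡ x
  lift-% x<M (above _) = m<n⇒m%n≡m x<M
  lift-% {x = x} x<M (below _) = trans ([m+n]%n≡m%n x M) (m<n⇒m%n≡m x<M)

  window-lift : ∀ {ρ k} → ρ < M → InWindow (suc ρ) m₁ k → Lift ρ (k % M) k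
  window-lift {ρ} {k} ρ<M (ρ<k , k<end) with k <? M
  ... | yes k<M rewrite m<n⇒m%n≡m k<M = above ρ<k
  ... | no k≮M = subst₂ (Lift ρ) k∸M≡k%M (m∸n+n≡m M≤k) (below k∸M<ρ)
    where
    M≤k = ≮⇒≥ k≮M
    k∸M<ρ : k ∸ M < ρ
    k∸M<ρ = +-cancelʳ-< M (k ∸ M) ρ (subst₂ _<_ (sym (m∸n+n≡m M≤k)) (sym (+-suc ρ m₁)) k<end)
    k∸M≡k%M : k ∸ M ≡ k % M
    k∸M≡k%M = trans (sym (m<n⇒m%n≡m (<-trans k∸M<ρ ρ<M))) (m≤n⇒[n∸m]%m≡n%m M≤k)

  CycleSucc : ℕ → ℕ → Set
  CycleSucc a b = b ≡ suc a ⊎ (a ≡ m₁ × b ≡ 0)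

  cycleAdjacent⇒succ : ∀ {a b} → CycleAdjacent a b → CycleSucc a b ⊎ CycleSucc b a
  cycleAdjacent⇒succ (inj₁ (inj₁ b≡1+a))         = inj₁ (inj₁ b≡1+a)
  cycleAdjacent⇒succ (inj₁ (inj₂ a≡1+b))         = inj₂ (inj₁ a≡1+b)
  cycleAdjacent⇒succ (inj₂ (inj₁ (a≡0 , b≡m₁))) = inj₂ (inj₂ (b≡m₁ , a≡0))
  cycleAdjacent⇒succ (inj₂ (inj₂ (b≡0 , a≡m₁))) = inj₁ (inj₂ (a≡m₁ , b≡0))

  lift-succ : ∀ {ρ a b pa pb} → ρ < M → CycleSucc a b → Lift ρ a pa → Lift ρ b pb → pb ≡ suc pa
  lift-succ _   (inj₁ refl)          (above _)   (above _)     = refl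
  lift-succ _   (inj₁ refl)          (below _)   (below _)     = refl
  lift-succ _   (inj₁ refl)          (above ρ<a) (below 1+a<ρ) = contradiction (<-trans ρ<a (n<1+n _)) (<-asym 1+a<ρ)
  lift-succ _   (inj₁ refl)          (below a<ρ) (above ρ<1+a) = contradiction a<ρ (≤⇒≯ (s≤s⁻¹ ρ<1+a))
  lift-succ _   (inj₂ (refl , refl)) (above _)   (below _)     = refl
  lift-succ _   (inj₂ (refl , refl)) _           (above ())
  lift-succ ρ<M (inj₂ (refl , refl)) (below m₁<ρ) _          = contradiction m₁<ρ (≤⇒≯ (s≤s⁻¹ ρ<M))

  lifts-adjacent : ∀ {ρ a b pa pb} → ρ < M → CycleAdjacent a b → Lift ρ a pa → Lift ρ b pb → Adjacent pa pb
  lifts-adjacent ρ<M adj la lb with cycleAdjacent⇒succ adj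
  ... | inj₁ a→b = inj₁ (lift-succ ρ<M a→b la lb)
  ... | inj₂ b→a = inj₂ (lift-succ ρ<M b→a lb la)

  lift-robber-neighbour : ∀ {ρ a pa} → CycleAdjacent a ρ → Lift ρ a pa → pa ≡ suc ρ ⊎ suc pa ≡ ρ + M
  lift-robber-neighbour adj la with cycleAdjacent⇒succ adj
  lift-robber-neighbour _ (below _)       | inj₁ (inj₁ refl)          = inj₂ refl
  lift-robber-neighbour _ (above 1+a<a)   | inj₁ (inj₁ refl)          = contradiction 1+a<a (<-asym (n<1+n _))
  lift-robber-neighbour _ (above _)       | inj₁ (inj₂ (refl , refl)) = inj₂ refl
  lift-robber-neighbour _ (below ())      | inj₁ (inj₂ (refl , refl))
  lift-robber-neighbour _ (above _)       | inj₂ (inj₁ refl)          = inj₁ refl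
  lift-robber-neighbour _ (below 1+ρ<ρ)   | inj₂ (inj₁ refl)          = contradiction 1+ρ<ρ (<-asym (n<1+n _))
  lift-robber-neighbour _ (below _)       | inj₂ (inj₂ (refl , refl)) = inj₁ refl
  lift-robber-neighbour _ (above ())      | inj₂ (inj₂ (refl , refl))

  periodic : (ℕ → ℕ) → ℕ → ℕ
  periodic f k = f (k % M)

  CycleQuiet : (ℕ → ℕ) → ℕ → Set
  CycleQuiet f ρ = Quiet (f ρ) (sweepRight (periodic f) 0 (suc ρ) m₁) (sweepLeft (periodic f) 0 (suc ρ) m₁)

  cycleQuiet-neighbour : ∀ {ρ f a} → 1 ≤ m₁ → ρ < M → a < M → a ≢ ρ → CycleAdjacent a ρ →
                         2 ≤ f a → ¬ CycleQuiet f ρ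
  cycleQuiet-neighbour {ρ} {f} {a} 1≤m₁ ρ<M a<M a≢ρ adj 2≤fa (_ , left≤1 , right≤1)
    with lift a≢ρ
  ... | pa , la with lift-robber-neighbour adj la
  ...   | inj₁ refl = 1+n≰n (≤-trans (≤-trans 2≤f[pa] (sweepLeft-head (periodic f) 0 pa 1≤m₁)) right≤1)
    where 2≤f[pa] = subst (λ x → 2 ≤ f x) (sym (lift-% a<M la)) 2≤fa
  ...   | inj₂ 1+pa≡ρ+M = 1+n≰n (≤-trans (≤-trans 2≤f[pa] last≤) left≤1)
    where
    2≤f[pa] = subst (λ x → 2 ≤ f x) (sym (lift-% a<M la)) 2≤fa
    last≤ = sweepRight-last (periodic f) 0 (suc ρ) (proj₁ (lift-∈ ρ<M a<M la)) (trans 1+pa≡ρ+M (+-suc ρ m₁))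

  cycleQuiet-step : ∀ {ρ f f' a b} → 1 ≤ m₁ → ρ < M → a < M → b < M → CycleAdjacent a b →
                    PebbleStep f f' a b → CycleQuiet f ρ → CycleQuiet f' ρ
  cycleQuiet-step {ρ} {f} {f'} {a} {b} 1≤m₁ ρ<M a<M b<M adj step quiet@(fρ≡0 , _)
    with a ≟ ρ | b ≟ ρ
  ... | yes refl | _        = contradiction (≤-trans (pebbleStep-source≥2 step) (≤-reflexive fρ≡0)) λ ()
  ... | no a≢ρ   | yes refl =
    contradiction quiet (cycleQuiet-neighbour 1≤m₁ ρ<M a<M a≢ρ adj (pebbleStep-source≥2 step))
  ... | no a≢ρ   | no b≢ρ   =
    quiet-dominated quiet (others ρ (a≢ρ ∘ sym) (b≢ρ ∘ sym))
      (proj₁ dominated ≤-refl) (proj₂ dominated ≤-refl)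
    where
    open PebbleStep step
    pa = proj₁ (lift a≢ρ)
    la = proj₂ (lift a≢ρ)
    pb = proj₁ (lift b≢ρ)
    lb = proj₂ (lift b≢ρ)
    residue-unique : ∀ {x px k} → Lift ρ x px → InWindow (suc ρ) m₁ k → k % M ≡ x → k ≡ px
    residue-unique lx k∈ k%M≡x = lift-unique (subst (λ x → Lift ρ x _) k%M≡x (window-lift ρ<M k∈)) lx
    dominated : SweepsDominated (periodic f') (periodic f) (suc ρ) m₁
    dominated = sweeps-step (lifts-adjacent ρ<M adj la lb) (lift-∈ ρ<M a<M la) (lift-∈ ρ<M b<M lb)
      (subst (λ x → 2 + f' x ≤ f x) (sym (lift-% a<M la)) source)
      (subst (λ x → f' x ≤ suc (f x)) (sym (lift-% b<M lb)) target)
      (λ k k∈ k≢pa k≢pb → others (k % M) (k≢pa ∘ residue-unique la k∈) (k≢pb ∘ residue-unique lb k∈))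

  CycleCovered : (ℕ → ℕ) → ℕ → Set
  CycleCovered f ρ = Covered (f ρ) (sweepRight (periodic f) 0 (suc ρ) m₁) (sweepLeft (periodic f) 0 (suc ρ) m₁)

  periodic-+multiple : ∀ f q k → periodic f (k + q * M) ≡ periodic f k
  periodic-+multiple f q k = cong f ([m+kn]%n≡m%n k q M)

  cycleCovered⇒coveredAt : ∀ {f ρ} → ρ < M → CycleCovered f ρ →
                           ∀ q N → suc (ρ + suc q * M) + m₁ ≤ N → CoveredAt (periodic f) N (ρ + suc q * M)
  cycleCovered⇒coveredAt {f} {ρ} ρ<M covered q N fits = covered-mono covered cell left right
    where
    g = periodic f
    p = ρ + suc q * M
    cell : f ρ ≤ g p
    cell = ≤-reflexive (sym (cong f (trans ([m+kn]%n≡m%n ρ (suc q) M) (m<n⇒m%n≡m ρ<M))))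
    p≡ : ∀ ρ q m₁ → ρ + suc q * suc m₁ ≡ suc ρ + q * suc m₁ + m₁
    p≡ = solve-∀
    left : sweepRight g 0 (suc ρ) m₁ ≤ sweepRight g 0 0 p
    left = begin
      sweepRight g 0 (suc ρ) m₁                ≡⟨ sweepRight-periodic (periodic-+multiple f q) m₁ (suc ρ) 0 ⟨
      sweepRight g 0 (suc ρ + q * M) m₁        ≤⟨ sweepRight-suffix g (suc ρ + q * M) m₁ ⟩
      sweepRight g 0 0 (suc ρ + q * M + m₁)    ≡⟨ cong (sweepRight g 0 0) (p≡ ρ q m₁) ⟨
      sweepRight g 0 0 p                       ∎
      where open ≤-Reasoning
    room : ∃ λ u → m₁ + u ≡ N ∸ suc p
    room = m≤n⇒∃[o]m+o≡n (m+n≤o⇒m≤o∸n m₁ (≤-trans (≤-reflexive (+-comm m₁ (suc p))) fits))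
    right : sweepLeft g 0 (suc ρ) m₁ ≤ sweepLeft g 0 (suc p) (N ∸ suc p)
    right = begin
      sweepLeft g 0 (suc ρ) m₁                 ≡⟨ sweepLeft-periodic (periodic-+multiple f (suc q)) m₁ (suc ρ) 0 ⟨
      sweepLeft g 0 (suc p) m₁                 ≤⟨ sweepLeft-prefix g (suc p) m₁ (proj₁ room) ⟩
      sweepLeft g 0 (suc p) (m₁ + proj₁ room)  ≡⟨ cong (sweepLeft g 0 (suc p)) (proj₂ room) ⟩
      sweepLeft g 0 (suc p) (N ∸ suc p)        ∎
      where open ≤-Reasoning

  periodic-+M : ∀ f k → periodic f (k + M) ≡ periodic f k
  periodic-+M f k = cong f ([m+n]%n≡m%n k M)

  cycle-count-periods : ∀ {f} → (∀ ρ → ρ < M → CycleCovered f ρ) → ∀ K →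
                        2 * (K * M) ≤ 3 * (suc (suc K) * windowSum (periodic f) 0 M)
  cycle-count-periods {f} covered K = begin
    2 * (K * M)                                              ≡⟨ cong (2 *_) (m+n∸m≡n M (K * M)) ⟨
    2 * (suc K * M ∸ M)
      ≤⟨ *-monoʳ-≤ 2 (coveredCount-≥ {lo = M} N 0 refl refl z≤n (m≤n+m _ M) coveredAt) ⟩
    2 * coveredCount g 0 0 N                                 ≤⟨ m≤m+n _ _ ⟩
    2 * coveredCount g 0 0 N + movable (sweepLeft g 0 0 N)   ≤⟨ coveredCount-bound g N 0 0 ⟩
    3 * windowSum g 0 N + 0                                  ≡⟨ +-identityʳ _ ⟩
    3 * windowSum g 0 N
      ≡⟨ cong (3 *_) (windowSum-periods (periodic-+M f) (suc (suc K))) ⟩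
    3 * (suc (suc K) * windowSum g 0 M)                      ∎
    where
    open ≤-Reasoning
    g = periodic f
    N = suc (suc K) * M
    coveredAt : ∀ p → M ≤ p → p < suc K * M → CoveredAt g N p
    coveredAt p M≤p p<hi with p / M | m≡m%n+[m/n]*n p M
    ... | zero  | p≡ = contradiction (subst (_< M) (sym (trans p≡ (+-identityʳ _))) (m%n<n p M)) (≤⇒≯ M≤p)
    ... | suc q | p≡ = subst (CoveredAt g N) (sym p≡) (cycleCovered⇒coveredAt {f} ρ<M (covered _ ρ<M) q N fits)
      where
      ρ<M = m%n<n p M
      fits : suc (p % M + suc q * M) + m₁ ≤ N
      fits = subst (λ x → suc x + m₁ ≤ N) p≡
               (≤-trans (+-mono-≤ p<hi (n≤1+n m₁)) (≤-reflexive (+-comm (suc K * M) M)))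

  cycle-count : ∀ {f} → (∀ ρ → ρ < M → CycleCovered f ρ) → 2 * M ≤ 3 * windowSum f 0 M
  cycle-count {f} covered =
    scaled-slack K (3 * S) (2 * M) (subst₂ _≤_ (rearrangeˡ K M) (rearrangeʳ K S) bound) (n<1+n _)
    where
    S = windowSum f 0 M
    -- enough periods for the two uncounted ones at the ends to be absorbed, see scaled-slack
    K = suc (2 * (3 * S))
    bound : 2 * (K * M) ≤ 3 * (suc (suc K) * S)
    bound = subst (λ z → 2 * (K * M) ≤ 3 * (suc (suc K) * z))
              (windowSum-cong M 0 (λ k (_ , k<M) → cong f (m<n⇒m%n≡m k<M)))
              (cycle-count-periods covered K)
    rearrangeˡ : ∀ K M → 2 * (K * M) ≡ K * (2 * M)
    rearrangeˡ = solve-∀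
    rearrangeʳ : ∀ K S → 3 * (suc (suc K) * S) ≡ (K + 2) * (3 * S)
    rearrangeʳ = solve-∀

cycleAdjacent-irreflexive : ∀ {m₁ a b} → 1 ≤ m₁ → CycleAdjacent m₁ a b → a ≢ b
cycleAdjacent-irreflexive _   (inj₁ adj)                 = adjacent-irreflexive adj
cycleAdjacent-irreflexive 1≤m₁ (inj₂ (inj₁ (refl , refl))) refl = contradiction 1≤m₁ λ ()
cycleAdjacent-irreflexive 1≤m₁ (inj₂ (inj₂ (refl , refl))) refl = contradiction 1≤m₁ λ ()

cycle-winning⇒size≥ : ∀ m₁ → 1 ≤ m₁ → (C : Config (Cycle (suc m₁))) → Winning (Cycle (suc m₁)) C →
              ceil2n/3 (suc m₁) ≤ size (Cycle (suc m₁)) C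
cycle-winning⇒size≥ m₁ 1≤m₁ C win with all? (λ (r : Fin (suc m₁)) → covered? _ _ _)
... | yes allCovered =
  ceil2n/3-≤ (suc m₁) _ (subst (λ S → 2 * suc m₁ ≤ 3 * S) (sym (sum-tabulate≡windowSum C))
    (cycle-count m₁ (λ ρ ρ<M → subst (CycleCovered m₁ (extend C)) (toℕ-fromℕ< ρ<M) (allCovered (fromℕ< ρ<M)))))
... | no notAll with ¬∀⟶∃¬ (suc m₁) _ (λ r → covered? _ _ _) notAll
...   | r , ¬covered =
  contradiction (win r) (quiet-evades (Cycle (suc m₁)) r (λ f → CycleQuiet m₁ f (toℕ r)) proj₁
    (λ {_} {_} {u} {v} adj → cycleQuiet-step m₁ 1≤m₁ (toℕ<n r) (toℕ<n u) (toℕ<n v) adj)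
    (λ adj → cycleAdjacent-irreflexive 1≤m₁ adj ∘ cong toℕ)
    (uncovered⇒quiet ¬covered))

-- An optimal configuration

guard : ℕ → ℕ → ℕ
guard 0                        _                   = 0
guard 1                        _                   = 1
guard 2                        0                   = 2
guard 2                        (suc _)             = 0
guard (suc (suc (suc m)))      0                   = 0
guard (suc (suc (suc m)))      1                   = 2
guard (suc (suc (suc m)))      2                   = 0
guard (suc (suc (suc m)))      (suc (suc (suc k))) = guard m k

guard-covers : ∀ m k → k < m → 1 ≤ guard m k ⊎ ∃ λ j → j < m × Adjacent j k × 2 ≤ guard m j
guard-covers 1                   0 _ = inj₁ ≤-refl
guard-covers 2                   0 _ = inj₁ (s≤s z≤n)
guard-covers 2                   1 _ = inj₂ (0 , s≤s z≤n , inj₁ refl , ≤-refl)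
guard-covers 1 (suc _) (s≤s ())
guard-covers 2 (suc (suc _)) (s≤s (s≤s ()))
guard-covers (suc (suc (suc m))) 0 _ = inj₂ (1 , s≤s (s≤s z≤n) , inj₂ refl , ≤-refl)
guard-covers (suc (suc (suc m))) 1 _ = inj₁ (s≤s z≤n)
guard-covers (suc (suc (suc m))) 2 _ = inj₂ (1 , s≤s (s≤s z≤n) , inj₁ refl , ≤-refl)
guard-covers (suc (suc (suc m))) (suc (suc (suc k))) (s≤s (s≤s (s≤s k<m))) with guard-covers m k k<m
... | inj₁ 1≤guard = inj₁ 1≤guard
... | inj₂ (j , j<m , adjacent , 2≤guard) = inj₂ (3 + j , s≤s (s≤s (s≤s j<m)) , shift adjacent , 2≤guard)
  where
  shift : Adjacent j k → Adjacent (3 + j) (3 + k)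
  shift (inj₁ refl) = inj₁ refl
  shift (inj₂ refl) = inj₂ refl

ceil2n/3-+3 : ∀ m → ceil2n/3 (3 + m) ≡ 2 + ceil2n/3 m
ceil2n/3-+3 m = trans (cong (_/ 3) (regroup m)) (trans ([x+k*3]/3 (2 * m + 2) 2) (+-comm _ 2))
  where
  regroup : ∀ m → 2 * (3 + m) + 2 ≡ 2 * m + 2 + 2 * 3
  regroup = solve-∀

guard-size : ∀ m → windowSum (guard m) 0 m ≡ ceil2n/3 m
guard-size 0 = refl
guard-size 1 = refl
guard-size 2 = refl
guard-size (suc (suc (suc m))) =
  trans (cong (2 +_) (trans (sym (windowSum-shift (guard (3 + m)) 3 m 0)) (guard-size m))) (sym (ceil2n/3-+3 m))

capture-from-neighbour : ∀ G {C : Config G} {u r} → Adj G u r → 2 ≤ C u → CopWin G C r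
capture-from-neighbour G {C} {u} {r} adj 2≤Cu =
  turn (pebble G C u r) ((u , r , adj , 2≤Cu , refl) ◅ ε) (inj₁ arrives)
  where
  arrives : 1 ≤ pebble G C u r r
  arrives with r F.≟ r
  ... | yes _   = s≤s z≤n
  ... | no r≢r = contradiction refl r≢r

guardConfig : (G : Graph) → Config G
guardConfig G w = guard (n G) (toℕ w)

guardConfig-size : ∀ G → size G (guardConfig G) ≡ ceil2n/3 (n G)
guardConfig-size G = begin
  size G (guardConfig G)                      ≡⟨ sum-tabulate≡windowSum (guardConfig G) ⟩
  windowSum (extend (guardConfig G)) 0 (n G)  ≡⟨ windowSum-cong (n G) 0 extend-guard ⟩
  windowSum (guard (n G)) 0 (n G)             ≡⟨ guard-size (n G) ⟩
  ceil2n/3 (n G)                              ∎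
  where
  open ≡-Reasoning
  extend-guard : ∀ k → InWindow 0 (n G) k → extend (guardConfig G) k ≡ guard (n G) k
  extend-guard k (_ , k<n) = trans (extend-fromℕ< (guardConfig G) k<n) (cong (guard (n G)) (toℕ-fromℕ< k<n))

guardConfig-winning : ∀ G → (∀ {u v} → Adj (Path (n G)) u v → Adj G u v) → Winning G (guardConfig G)
guardConfig-winning G path⊆G r with guard-covers (n G) (toℕ r) (toℕ<n r)
... | inj₁ 1≤guard = caught 1≤guard
... | inj₂ (j , j<n , adjacent , 2≤guard) =
  capture-from-neighbour G (path⊆G (subst (λ x → Adjacent x (toℕ r)) (sym j≡) adjacent))
                           (subst (λ x → 2 ≤ guard (n G) x) (sym j≡) 2≤guard)
  where j≡ = toℕ-fromℕ< j<n

theorem11 : ((m : ℕ) → m ≥ 1 → IsCopPebblingNumber (Path m) (ceil2n/3 m))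
            × ((m : ℕ) → m ≥ 3 → IsCopPebblingNumber (Cycle m) (ceil2n/3 m))
theorem11 = path , cycle
  where
  path : (m : ℕ) → m ≥ 1 → IsCopPebblingNumber (Path m) (ceil2n/3 m)
  path m _ = (guardConfig (Path m) , guardConfig-size (Path m) , guardConfig-winning (Path m) (λ adj → adj))
           , path-winning⇒size≥ m
  cycle : (m : ℕ) → m ≥ 3 → IsCopPebblingNumber (Cycle m) (ceil2n/3 m)
  cycle (suc m₁) (s≤s 2≤m₁) =
    (guardConfig (Cycle (suc m₁)) , guardConfig-size (Cycle (suc m₁)) , guardConfig-winning (Cycle (suc m₁)) inj₁)
    , cycle-winning⇒size≥ m₁ (≤-trans (s≤s z≤n) 2≤m₁)
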